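{- Let $q$ be a prime power and let $m\ge 2$ and $j$ be integers with $1\le j\le q^m-1$ and $\gcd(j,q^m-1)=1$. Let $h(x)\in\mathbb{F}_q[x]$. Then $x\,h(\mu_j(x))$ is a permutation polynomial of $\mathbb{F}_{q^m}$ if and only if $h(0)\ne0$ and $x\,h(x)^j$ permutes $\mathbb{F}_q$.
   Context: $\mu_j(x):=\sum_{i=0}^{m-1}x^{jq^i}=\mathrm{Tr}_{\mathbb{F}_{q^m}/\mathbb{F}_q}(x^j)$, where $\mathrm{Tr}_{\mathbb{F}_{q^m}/\mathbb{F}_q}(x)=x+x^q+\cdots+x^{q^{m-1}}$. A permutation polynomial of a finite field $K$ is a polynomial inducing a bijection of $K$. -}

module Defs where

open import Level using (Level; _⊔_) renaming (suc to lsuc)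
open import Data.Nat as ℕ using (ℕ; zero; suc; _∸_; _≤_)
open import Data.Nat.Primality using (Prime)
open import Data.Fin using (Fin)
open import Data.List using (List; []; _∷_)
open import Data.List.Relation.Unary.All using (All)
open import Data.Product using (Σ; ∃; _×_; _,_)
open import Relation.Nullary using (¬_)
open import Relation.Binary.PropositionalEquality as ≡ using (_≡_)
open import Algebra.Bundles using (CommutativeRing; Semiring)
open import Function.Bundles using (Bijection)
import Algebra.Definitions.RawSemiring as RS

IsPrimePower : ℕ → Set
IsPrimePower q = Σ ℕ λ p → Σ ℕ λ k → Prime p × 1 ≤ k × q ≡ p ℕ.^ k

record Field (c ℓ : Level) : Set (lsuc (c ⊔ ℓ)) where
  field
    commutativeRing : CommutativeRing c ℓ
  open CommutativeRing commutativeRing public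
  field
    0≉1     : ¬ (0# ≈ 1#)
    inverse : ∀ x → ¬ (x ≈ 0#) → ∃ λ y → (x * y) ≈ 1#

record FiniteField (c ℓ : Level) (n : ℕ) : Set (lsuc (c ⊔ ℓ)) where
  field
    field' : Field c ℓ
  open Field field' public
  field
    card : Bijection setoid (≡.setoid (Fin n))

module FieldOps {c ℓ} (F : Field c ℓ) where
  open Field F
  open RS (Semiring.rawSemiring semiring) public using (_^_)

  -- polynomials as coefficient lists, constant term first: a₀ ∷ a₁ ∷ …
  Poly : Set c
  Poly = List Carrier

  eval : Poly → Carrier → Carrier
  eval []       x = 0#
  eval (a ∷ as) x = a + x * eval as x

  sumTo : ℕ → (ℕ → Carrier) → Carrier
  sumTo zero    f = 0#
  sumTo (suc m) f = sumTo m f + f m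

  -- membership in the subfield F_q = { x | x^q = x } of F_{q^m}
  InSub : ℕ → Carrier → Set ℓ
  InSub q x = (x ^ q) ≈ x

  PolyOver : ℕ → Poly → Set (c ⊔ ℓ)
  PolyOver q h = All (InSub q) h

  -- μ_j(x) = Σ_{i=0}^{m-1} x^{j q^i} = Tr_{F_{q^m}/F_q}(x^j)
  μ : ℕ → ℕ → ℕ → Carrier → Carrier
  μ q m j x = sumTo m (λ i → x ^ (j ℕ.* (q ℕ.^ i)))

  Permutes : (Carrier → Carrier) → Set (c ⊔ ℓ)
  Permutes f = (∀ x y → f x ≈ f y → x ≈ y) × (∀ y → ∃ λ x → f x ≈ y)

  PermutesOn : (Carrier → Set ℓ) → (Carrier → Carrier) → Set (c ⊔ ℓ)
  PermutesOn P f =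
    (∀ x → P x → P (f x)) ×
    (∀ x y → P x → P y → f x ≈ f y → x ≈ y) ×
    (∀ y → P y → ∃ λ x → P x × f x ≈ y)

module Submission where

-- Idea.  μ_j(x) = Tr(x^j), where Tr(y) = y + y^q + … + y^(q^(m-1)) is F_q-linear, and h(μ_j x)^j
-- lies in F_q, so μ_j(f(x)) = g(μ_j(x)).  Since x ↦ x^j is a bijection of K and Tr maps K onto
-- F_q, μ_j maps K onto F_q.  If g permutes F_q and h(0) ≠ 0, the square shows f is injective,
-- hence bijective (K is finite).  Conversely, if f permutes K then g maps F_q onto F_q, hence
-- permutes it; and h(0) = 0 would make μ_j vanish only at 0, so Tr would vanish only at 0, which
-- forces K = F_q, impossible for m ≥ 2.

open import Defs
open import Data.Nat using (ℕ; _≤_; _∸_; _^_)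
open import Data.Nat.GCD using (gcd)
open import Data.Product using (_×_)
open import Function.Bundles using (_⇔_)
open import Relation.Nullary using (¬_)
open import Relation.Binary.PropositionalEquality using (_≡_)
open import Level using (Level)

open import Level using (_⊔_)
import Data.Nat as ℕ
import Data.Nat.Properties as ℕP
open import Data.Nat.Combinatorics using (_C_; nC1≡n; nCn≡1; nCk+nC[k+1]≡[n+1]C[k+1])
open import Data.Nat.Divisibility using (_∣_; divides; ∣⇒≤)
open import Data.Nat.Primality using (Prime; euclidsLemma; ¬prime[0]; ¬prime[1])
open import Data.Nat.GCD using (module Bézout)
open import Data.Nat.Coprimality using (coprime-Bézout; gcd≡1⇒coprime)
open import Data.Fin as Fin using (Fin)
import Data.Fin.Properties as FinP
open import Data.Fin.Permutation using (Permutation; permutation)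
open import Data.List using ([]; _∷_)
open import Data.List.Relation.Unary.All using ([]; _∷_)
open import Data.Product using (∃; _,_; proj₁; proj₂)
open import Data.Sum using (_⊎_; inj₁; inj₂)
open import Data.Empty using (⊥-elim)
open import Relation.Nullary using (Dec; yes; no)
open import Algebra.Bundles using (CommutativeMonoid)
open import Function.Bundles using (Bijection; mk⇔)
import Algebra.Properties.CommutativeMonoid.Sum as MonoidSum
import Relation.Binary.PropositionalEquality as ≡
open import Relation.Binary.PropositionalEquality using (_≢_)

module Binomials where
  open ≡.≡-Reasoning

  absorption : ∀ n k → ℕ.suc k ℕ.* (ℕ.suc n C ℕ.suc k) ≡ ℕ.suc n ℕ.* (n C k)
  absorption ℕ.zero ℕ.zero = ≡.refl
  absorption ℕ.zero (ℕ.suc k) = ℕP.*-zeroʳ (ℕ.suc (ℕ.suc k))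
  absorption (ℕ.suc n) ℕ.zero =
    ≡.trans (ℕP.*-identityˡ _) (≡.trans (nC1≡n (ℕ.suc (ℕ.suc n))) (≡.sym (ℕP.*-identityʳ _)))
  absorption (ℕ.suc n) (ℕ.suc k) = begin
    (2 ℕ.+ k) ℕ.* ((2 ℕ.+ n) C (2 ℕ.+ k))
      ≡⟨ ≡.cong ((2 ℕ.+ k) ℕ.*_) (≡.sym (nCk+nC[k+1]≡[n+1]C[k+1] (ℕ.suc n) (ℕ.suc k))) ⟩
    (2 ℕ.+ k) ℕ.* (a ℕ.+ b)
      ≡⟨ solve 3 (λ k a b → (con 2 :+ k) :* (a :+ b) := a :+ ((con 1 :+ k) :* a :+ (con 2 :+ k) :* b)) ≡.refl k a b ⟩
    a ℕ.+ ((1 ℕ.+ k) ℕ.* a ℕ.+ (2 ℕ.+ k) ℕ.* b)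
      ≡⟨ ≡.cong (a ℕ.+_) (≡.cong₂ ℕ._+_ (absorption n k) (absorption n (ℕ.suc k))) ⟩
    a ℕ.+ ((1 ℕ.+ n) ℕ.* (n C k) ℕ.+ (1 ℕ.+ n) ℕ.* (n C ℕ.suc k))
      ≡⟨ ≡.cong (a ℕ.+_) (≡.sym (ℕP.*-distribˡ-+ (ℕ.suc n) (n C k) (n C ℕ.suc k))) ⟩
    a ℕ.+ (1 ℕ.+ n) ℕ.* ((n C k) ℕ.+ (n C ℕ.suc k))
      ≡⟨ ≡.cong (λ z → a ℕ.+ (1 ℕ.+ n) ℕ.* z) (nCk+nC[k+1]≡[n+1]C[k+1] n k) ⟩
    a ℕ.+ (1 ℕ.+ n) ℕ.* a ∎
    where
      open import Data.Nat.Solver using (module +-*-Solver)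
      open +-*-Solver
      a b : ℕ
      a = ℕ.suc n C ℕ.suc k
      b = ℕ.suc n C ℕ.suc (ℕ.suc k)

  -- For a prime p and 0 < k < p, p divides C(p,k): by absorption p ∣ k·C(p,k), and p ∤ k.
  prime∣binomial : ∀ {p} → Prime p → ∀ k → 0 ℕ.< k → k ℕ.< p → p ∣ (p C k)
  prime∣binomial {ℕ.suc n} p-prime (ℕ.suc k) _ k<p
    with euclidsLemma (ℕ.suc k) (ℕ.suc n C ℕ.suc k) p-prime
           (divides (n C k) (≡.trans (absorption n k) (ℕP.*-comm (ℕ.suc n) (n C k))))
  ... | inj₁ p∣k = ⊥-elim (ℕP.<⇒≱ k<p (∣⇒≤ p∣k))
  ... | inj₂ p∣C = p∣C

module FieldLemmas {c ℓ} (F : Field c ℓ) where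
  open Field F
  open FieldOps F renaming (_^_ to _^ᴷ_)
  open import Algebra.Properties.Semiring.Exp semiring using (^-congˡ; ^-congʳ; ^-assocʳ)
  open import Algebra.Properties.Ring ring using (x∙y⁻¹≈ε⇒x≈y)
  open import Algebra.Properties.CommutativeSemigroup +-commutativeSemigroup using ()
    renaming (interchange to +-interchange)
  open import Algebra.Properties.CommutativeSemigroup *-commutativeSemigroup using ()
    renaming (x∙yz≈y∙xz to *-swap)
  open import Algebra.Properties.Semiring.Mult semiring using (×-congˡ; ×-homo-1) renaming (_×_ to _·_)
  open import Algebra.Properties.CommutativeSemiring.Binomial commutativeSemiring using (theorem; binomialTerm)
  open import Relation.Binary.Reasoning.Setoid setoid
  private module Σ = MonoidSum +-commutativeMonoid

  *-cancelʳ-nonzero : ∀ {x y z} → x ≉ 0# → y * x ≈ z * x → y ≈ z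
  *-cancelʳ-nonzero {x} {y} {z} x≉0 eq with inverse x x≉0
  ... | x⁻¹ , xx⁻¹≈1 = begin
    y                ≈⟨ sym (*-identityʳ y) ⟩
    y * 1#           ≈⟨ *-congˡ (sym xx⁻¹≈1) ⟩
    y * (x * x⁻¹)    ≈⟨ sym (*-assoc y x x⁻¹) ⟩
    (y * x) * x⁻¹    ≈⟨ *-congʳ eq ⟩
    (z * x) * x⁻¹    ≈⟨ *-assoc z x x⁻¹ ⟩
    z * (x * x⁻¹)    ≈⟨ *-congˡ xx⁻¹≈1 ⟩
    z * 1#           ≈⟨ *-identityʳ z ⟩
    z                ∎

  *-nonzero : ∀ {x y} → x ≉ 0# → y ≉ 0# → x * y ≉ 0#
  *-nonzero {x} {y} x≉0 y≉0 xy≈0 =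
    x≉0 (*-cancelʳ-nonzero y≉0 (trans xy≈0 (sym (zeroˡ y))))

  ^-nonzero : ∀ {x} n → x ≉ 0# → x ^ᴷ n ≉ 0#
  ^-nonzero ℕ.zero    x≉0 1≈0 = 0≉1 (sym 1≈0)
  ^-nonzero (ℕ.suc n) x≉0     = *-nonzero x≉0 (^-nonzero n x≉0)

  0^n≈0 : ∀ {n} → 1 ℕ.≤ n → 0# ^ᴷ n ≈ 0#
  0^n≈0 {ℕ.suc n} _ = zeroˡ _

  1^n≈1 : ∀ n → 1# ^ᴷ n ≈ 1#
  1^n≈1 ℕ.zero    = refl
  1^n≈1 (ℕ.suc n) = trans (*-identityˡ _) (1^n≈1 n)

  ^-multiple≈1 : ∀ {t a} → t ^ᴷ a ≈ 1# → ∀ x → t ^ᴷ (x ℕ.* a) ≈ 1#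
  ^-multiple≈1 {t} {a} tᵃ≈1 x = begin
    t ^ᴷ (x ℕ.* a)   ≡⟨ ≡.cong (t ^ᴷ_) (ℕP.*-comm x a) ⟩
    t ^ᴷ (a ℕ.* x)   ≈⟨ sym (^-assocʳ t a x) ⟩
    (t ^ᴷ a) ^ᴷ x    ≈⟨ ^-congˡ x tᵃ≈1 ⟩
    1# ^ᴷ x          ≈⟨ 1^n≈1 x ⟩
    1#               ∎

  bézout-step : ∀ {t a b} x y → t ^ᴷ a ≈ 1# → t ^ᴷ b ≈ 1# → 1 ℕ.+ x ℕ.* a ≡ y ℕ.* b → t ≈ 1#
  bézout-step {t} {a} {b} x y tᵃ≈1 tᵇ≈1 eq = begin
    t                          ≈⟨ sym (*-identityʳ t) ⟩
    t * 1#                     ≈⟨ *-congˡ (sym (^-multiple≈1 tᵃ≈1 x)) ⟩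
    t ^ᴷ (1 ℕ.+ x ℕ.* a)       ≡⟨ ≡.cong (t ^ᴷ_) eq ⟩
    t ^ᴷ (y ℕ.* b)             ≈⟨ ^-multiple≈1 tᵇ≈1 y ⟩
    1#                         ∎

  coprime-orders : ∀ {t a b} → t ^ᴷ a ≈ 1# → t ^ᴷ b ≈ 1# → Bézout.Identity 1 a b → t ≈ 1#
  coprime-orders tᵃ≈1 tᵇ≈1 (Bézout.+- x y eq) = bézout-step y x tᵇ≈1 tᵃ≈1 eq
  coprime-orders tᵃ≈1 tᵇ≈1 (Bézout.-+ x y eq) = bézout-step x y tᵃ≈1 tᵇ≈1 eq

  -- Polynomial functions, described without coefficient lists: 'Deg d lc f' says that f agrees
  -- with a polynomial function of degree ≤ d whose coefficient of x^d is lc.  It is defined by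
  -- the factor theorem: f x = f a + (x - a)·g x with g of degree ≤ d-1 and the same coefficient lc.
  Deg : ℕ.ℕ → Carrier → (Carrier → Carrier) → Set (c ⊔ ℓ)
  Deg ℕ.zero    lc f = ∀ x → f x ≈ lc
  Deg (ℕ.suc d) lc f = ∀ a → ∃ λ g → Deg d lc g × (∀ x → f x ≈ f a + (x - a) * g x)

  deg-lc : ∀ d {lc lc′ f} → Deg d lc f → lc ≈ lc′ → Deg d lc′ f
  deg-lc ℕ.zero    D lc≈lc′ x = trans (D x) lc≈lc′
  deg-lc (ℕ.suc d) D lc≈lc′ a with D a
  ... | g , Dg , f≈ = g , deg-lc d Dg lc≈lc′ , f≈

  deg-lift : ∀ d {lc f} → Deg d lc f → Deg (ℕ.suc d) 0# f
  deg-lift ℕ.zero {lc} {f} D a = (λ _ → 0#) , (λ _ → refl) , λ x → begin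
    f x                     ≈⟨ trans (D x) (sym (D a)) ⟩
    f a                     ≈⟨ sym (+-identityʳ _) ⟩
    f a + 0#                ≈⟨ +-congˡ (sym (zeroʳ _)) ⟩
    f a + (x - a) * 0#      ∎
  deg-lift (ℕ.suc d) D a with D a
  ... | g , Dg , f≈ = g , deg-lift d Dg , f≈

  deg-liftTo : ∀ d e {lc f} → Deg d lc f → d ℕ.< e → Deg e 0# f
  deg-liftTo d (ℕ.suc e) D (ℕ.s≤s d≤e) with ℕP.m≤n⇒m<n∨m≡n d≤e
  ... | inj₁ d<e    = deg-lift e (deg-liftTo d e D d<e)
  ... | inj₂ ≡.refl = deg-lift d D

  deg-zero : ∀ d → Deg d 0# (λ _ → 0#)
  deg-zero ℕ.zero    _ = refl
  deg-zero (ℕ.suc d)   = deg-lift d (deg-zero d)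

  deg-+ : ∀ d {a b f g} → Deg d a f → Deg d b g → Deg d (a + b) (λ x → f x + g x)
  deg-+ ℕ.zero Df Dg x = +-cong (Df x) (Dg x)
  deg-+ (ℕ.suc d) {f = f} {g} Df Dg a with Df a | Dg a
  ... | f′ , Df′ , f≈ | g′ , Dg′ , g≈ = (λ x → f′ x + g′ x) , deg-+ d Df′ Dg′ , λ x → begin
    f x + g x                                          ≈⟨ +-cong (f≈ x) (g≈ x) ⟩
    (f a + (x - a) * f′ x) + (g a + (x - a) * g′ x)    ≈⟨ +-interchange _ _ _ _ ⟩
    (f a + g a) + ((x - a) * f′ x + (x - a) * g′ x)    ≈⟨ +-congˡ (sym (distribˡ _ _ _)) ⟩
    (f a + g a) + (x - a) * (f′ x + g′ x)              ∎

  deg-scale : ∀ d {lc f} k → Deg d lc f → Deg d (k * lc) (λ x → k * f x)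
  deg-scale ℕ.zero k D x = *-congˡ (D x)
  deg-scale (ℕ.suc d) {f = f} k D a with D a
  ... | g , Dg , f≈ = (λ x → k * g x) , deg-scale d k Dg , λ x → begin
    k * f x                        ≈⟨ *-congˡ (f≈ x) ⟩
    k * (f a + (x - a) * g x)      ≈⟨ distribˡ _ _ _ ⟩
    k * f a + k * ((x - a) * g x)  ≈⟨ +-congˡ (*-swap k (x - a) (g x)) ⟩
    k * f a + (x - a) * (k * g x)  ∎

  split-at : ∀ x a y → x * y ≈ a * y + (x - a) * y
  split-at x a y = begin
    x * y                  ≈⟨ *-congʳ (sym (+-identityˡ x)) ⟩
    (0# + x) * y           ≈⟨ *-congʳ (+-congʳ (sym (-‿inverseʳ a))) ⟩
    ((a - a) + x) * y      ≈⟨ *-congʳ (+-assoc a (- a) x) ⟩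
    (a + (- a + x)) * y    ≈⟨ *-congʳ (+-congˡ (+-comm (- a) x)) ⟩
    (a + (x - a)) * y      ≈⟨ distribʳ y a (x - a) ⟩
    a * y + (x - a) * y    ∎

  deg-x* : ∀ d {lc f} → Deg d lc f → Deg (ℕ.suc d) lc (λ x → x * f x)
  deg-x* ℕ.zero {f = f} D a = f , D , λ x → begin
    x * f x                   ≈⟨ split-at x a (f x) ⟩
    a * f x + (x - a) * f x   ≈⟨ +-congʳ (*-congˡ (trans (D x) (sym (D a)))) ⟩
    a * f a + (x - a) * f x   ∎
  deg-x* (ℕ.suc d) {f = f} D a with D a
  ... | g , Dg , f≈ =
    (λ x → f x + a * g x) , deg-lc (ℕ.suc d) (deg-+ (ℕ.suc d) D (deg-lift d (deg-scale d a Dg))) (+-identityʳ _) ,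
    λ x → begin
      x * f x                                          ≈⟨ split-at x a (f x) ⟩
      a * f x + (x - a) * f x                          ≈⟨ +-congʳ (*-congˡ (f≈ x)) ⟩
      a * (f a + (x - a) * g x) + (x - a) * f x        ≈⟨ +-congʳ (distribˡ _ _ _) ⟩
      (a * f a + a * ((x - a) * g x)) + (x - a) * f x  ≈⟨ +-assoc _ _ _ ⟩
      a * f a + (a * ((x - a) * g x) + (x - a) * f x)  ≈⟨ +-congˡ (+-comm _ _) ⟩
      a * f a + ((x - a) * f x + a * ((x - a) * g x))  ≈⟨ +-congˡ (+-congˡ (*-swap a (x - a) (g x))) ⟩
      a * f a + ((x - a) * f x + (x - a) * (a * g x))  ≈⟨ +-congˡ (sym (distribˡ _ _ _)) ⟩
      a * f a + (x - a) * (f x + a * g x)              ∎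

  deg-^ : ∀ n → Deg n 1# (λ x → x ^ᴷ n)
  deg-^ ℕ.zero    _ = refl
  deg-^ (ℕ.suc n)   = deg-x* n (deg-^ n)

  -- A nonzero polynomial function of degree ≤ d has at most d distinct roots:
  -- a root a gives f x = (x - a)·g x, and the remaining roots are roots of g.
  root-bound : ∀ d {lc f} → Deg d lc f → lc ≉ 0# → ∀ n (r : Fin n → Carrier) →
               (∀ i j → r i ≈ r j → i ≡ j) → (∀ i → f (r i) ≈ 0#) → n ℕ.≤ d
  root-bound d         D lc≉0 ℕ.zero    r r-inj roots = ℕ.z≤n
  root-bound ℕ.zero    D lc≉0 (ℕ.suc n) r r-inj roots = ⊥-elim (lc≉0 (trans (sym (D (r Fin.zero))) (roots Fin.zero)))
  root-bound (ℕ.suc d) {f = f} D lc≉0 (ℕ.suc n) r r-inj roots with D (r Fin.zero)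
  ... | g , Dg , f≈ = ℕ.s≤s (root-bound d Dg lc≉0 n (λ i → r (Fin.suc i))
                               (λ i j eq → FinP.suc-injective (r-inj _ _ eq)) g-roots)
    where
      a : Carrier
      a = r Fin.zero
      g-roots : ∀ i → g (r (Fin.suc i)) ≈ 0#
      g-roots i = *-cancelʳ-nonzero x-a≉0 (begin
        g x * (x - a)        ≈⟨ *-comm _ _ ⟩
        (x - a) * g x        ≈⟨ sym (+-identityˡ _) ⟩
        0# + (x - a) * g x   ≈⟨ +-congʳ (sym (roots Fin.zero)) ⟩
        f a + (x - a) * g x  ≈⟨ sym (f≈ x) ⟩
        f x                  ≈⟨ roots (Fin.suc i) ⟩
        0#                   ≈⟨ sym (zeroˡ _) ⟩
        0# * (x - a)         ∎)
        where
          x : Carrier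
          x = r (Fin.suc i)
          x-a≉0 : x - a ≉ 0#
          x-a≉0 x-a≈0 with r-inj _ _ (x∙y⁻¹≈ε⇒x≈y x a x-a≈0)
          ... | ()

  freshman's-dream : ∀ n → (∀ k → 0 ℕ.< k → k ℕ.< ℕ.suc n → ∀ z → (ℕ.suc n C k) · z ≈ 0#) →
                     ∀ x y → (x + y) ^ᴷ ℕ.suc n ≈ x ^ᴷ ℕ.suc n + y ^ᴷ ℕ.suc n
  freshman's-dream n inner-vanish x y = begin
    (x + y) ^ᴷ ℕ.suc n                             ≈⟨ theorem (ℕ.suc n) x y ⟩
    term Fin.zero + Σ.sum (λ i → term (Fin.suc i))   ≈⟨ +-cong first (Σ.sum-init-last (λ i → term (Fin.suc i))) ⟩
    y ^ᴷ ℕ.suc n + (Σ.sum inner + last)              ≈⟨ +-congˡ (+-cong inner≈0 (last≈ (FinP.toℕ-fromℕ n))) ⟩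
    y ^ᴷ ℕ.suc n + (0# + x ^ᴷ ℕ.suc n)               ≈⟨ +-congˡ (+-identityˡ _) ⟩
    y ^ᴷ ℕ.suc n + x ^ᴷ ℕ.suc n                      ≈⟨ +-comm _ _ ⟩
    x ^ᴷ ℕ.suc n + y ^ᴷ ℕ.suc n                      ∎
    where
      term : Fin (ℕ.suc (ℕ.suc n)) → Carrier
      term = binomialTerm x y (ℕ.suc n)
      inner : Fin n → Carrier
      inner i = term (Fin.suc (Fin.inject₁ i))
      last : Carrier
      last = term (Fin.suc (Fin.fromℕ n))
      first : term Fin.zero ≈ y ^ᴷ ℕ.suc n
      first = trans (+-identityʳ _) (*-identityˡ _)
      inner≈0 : Σ.sum inner ≈ 0#
      inner≈0 = trans (Σ.sum-cong-≋ {n} (λ i → inner-vanish _ (ℕ.s≤s ℕ.z≤n)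
                  (ℕ.s≤s (≡.subst (ℕ._< n) (≡.sym (FinP.toℕ-inject₁ i)) (FinP.toℕ<n i))) _))
                (Σ.sum-replicate-zero n)
      last≈ : ∀ {m} → m ≡ n → (ℕ.suc n C ℕ.suc m) · (x ^ᴷ ℕ.suc m * y ^ᴷ (n ℕ.∸ m)) ≈ x ^ᴷ ℕ.suc n
      last≈ ≡.refl = begin
        (ℕ.suc n C ℕ.suc n) · (x ^ᴷ ℕ.suc n * y ^ᴷ (n ℕ.∸ n))  ≈⟨ ×-congˡ (nCn≡1 (ℕ.suc n)) ⟩
        1 · (x ^ᴷ ℕ.suc n * y ^ᴷ (n ℕ.∸ n))                     ≈⟨ ×-homo-1 _ ⟩
        x ^ᴷ ℕ.suc n * y ^ᴷ (n ℕ.∸ n)                           ≈⟨ *-congˡ (^-congʳ y (ℕP.n∸n≡0 n)) ⟩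
        x ^ᴷ ℕ.suc n * 1#                                       ≈⟨ *-identityʳ _ ⟩
        x ^ᴷ ℕ.suc n                                            ∎

  eval-cong : ∀ h {x y} → x ≈ y → eval h x ≈ eval h y
  eval-cong []      _   = refl
  eval-cong (a ∷ h) x≈y = +-congˡ (*-cong x≈y (eval-cong h x≈y))

  sumTo-cong : ∀ n {f g} → (∀ i → f i ≈ g i) → sumTo n f ≈ sumTo n g
  sumTo-cong ℕ.zero    f≈g = refl
  sumTo-cong (ℕ.suc n) f≈g = +-cong (sumTo-cong n f≈g) (f≈g n)

  sumTo-+ : ∀ n f g → sumTo n (λ i → f i + g i) ≈ sumTo n f + sumTo n g
  sumTo-+ ℕ.zero    f g = sym (+-identityʳ 0#)
  sumTo-+ (ℕ.suc n) f g = trans (+-congʳ (sumTo-+ n f g)) (+-interchange _ _ _ _)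

  sumTo-scale : ∀ n a f → sumTo n (λ i → a * f i) ≈ a * sumTo n f
  sumTo-scale ℕ.zero    a f = sym (zeroʳ a)
  sumTo-scale (ℕ.suc n) a f = trans (+-congʳ (sumTo-scale n a f)) (sym (distribˡ _ _ _))

  sumTo-shift : ∀ n f → sumTo n (λ i → f (ℕ.suc i)) + f 0 ≈ sumTo n f + f n
  sumTo-shift ℕ.zero    f = refl
  sumTo-shift (ℕ.suc n) f = begin
    (sumTo n (λ i → f (ℕ.suc i)) + f (ℕ.suc n)) + f 0  ≈⟨ +-assoc _ _ _ ⟩
    sumTo n (λ i → f (ℕ.suc i)) + (f (ℕ.suc n) + f 0)  ≈⟨ +-congˡ (+-comm _ _) ⟩
    sumTo n (λ i → f (ℕ.suc i)) + (f 0 + f (ℕ.suc n))  ≈⟨ sym (+-assoc _ _ _) ⟩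
    (sumTo n (λ i → f (ℕ.suc i)) + f 0) + f (ℕ.suc n)  ≈⟨ +-congʳ (sumTo-shift n f) ⟩
    (sumTo n f + f n) + f (ℕ.suc n)                    ∎

  deg-sumTo : ∀ n e (exps : ℕ.ℕ → ℕ.ℕ) → (∀ i → i ℕ.< n → exps i ℕ.< e) →
              Deg e 0# (λ y → sumTo n (λ i → y ^ᴷ exps i))
  deg-sumTo ℕ.zero    e exps _        = deg-zero e
  deg-sumTo (ℕ.suc n) e exps exps<e = deg-lc e
    (deg-+ e (deg-sumTo n e exps (λ i i<n → exps<e i (ℕP.m<n⇒m<1+n i<n)))
             (deg-liftTo (exps n) e (deg-^ (exps n)) (exps<e n ℕP.≤-refl)))
    (+-identityʳ 0#)

module FiniteFieldLemmas {c ℓ N} (K : FiniteField c ℓ N) where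
  open FiniteField K
  open FieldOps field' renaming (_^_ to _^ᴷ_)
  open FieldLemmas field'
  open import Algebra.Properties.Semiring.Exp semiring using (^-congˡ; ^-assocʳ)
  open import Algebra.Properties.CommutativeSemiring.Exp commutativeSemiring using (^-distrib-*)
  open import Algebra.Properties.Ring ring using (+-identityˡ-unique)
  open import Algebra.Properties.Semiring.Mult semiring
    using (×-congʳ; ×-assoc-*; ×-assocˡ; ×1-homo-*) renaming (_×_ to _·_)
  open import Relation.Binary.Reasoning.Setoid setoid
  private module Σ = MonoidSum +-commutativeMonoid
  private module Π = MonoidSum *-commutativeMonoid
  open Bijection card using () renaming
    (to to index; cong to index-cong; injective to index-injective; to⁻ to element; strictlySurjective to index-surjective)

  index-element : ∀ i → index (element i) ≡ i
  index-element i = proj₂ (index-surjective i)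

  element-index : ∀ x → element (index x) ≈ x
  element-index x = index-injective (index-element (index x))

  element-injective : ∀ {i j} → element i ≈ element j → i ≡ j
  element-injective {i} {j} eq = ≡.trans (≡.sym (index-element i)) (≡.trans (index-cong eq) (index-element j))

  infix 4 _≈?_
  _≈?_ : ∀ x y → Dec (x ≈ y)
  x ≈? y with index x Fin.≟ index y
  ... | yes eq = yes (index-injective eq)
  ... | no  ne = no (λ x≈y → ne (index-cong x≈y))

  ^-zero⇒ : ∀ {x} n → x ^ᴷ n ≈ 0# → x ≈ 0#
  ^-zero⇒ {x} n xⁿ≈0 with x ≈? 0#
  ... | yes x≈0 = x≈0
  ... | no  x≉0 = ⊥-elim (^-nonzero n x≉0 xⁿ≈0)

  Fin-injective⇒surjective : ∀ {n} (f : Fin n → Fin n) → (∀ i j → f i ≡ f j → i ≡ j) → ∀ k → ∃ λ i → f i ≡ k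
  Fin-injective⇒surjective {ℕ.suc n} f f-inj k with FinP.any? (λ i → f i Fin.≟ k)
  ... | yes hit = hit
  ... | no miss = ⊥-elim (ℕP.<-irrefl ≡.refl (FinP.injective⇒≤ {f = squeeze} squeeze-injective))
    where
      avoids : ∀ i → k ≢ f i
      avoids i eq = miss (i , ≡.sym eq)
      squeeze : Fin (ℕ.suc n) → Fin n
      squeeze i = Fin.punchOut (avoids i)
      squeeze-injective : ∀ {i j} → squeeze i ≡ squeeze j → i ≡ j
      squeeze-injective eq = f-inj _ _ (FinP.punchOut-injective (avoids _) (avoids _) eq)

  injective⇒surjective : (f : Carrier → Carrier) → (∀ x y → f x ≈ f y → x ≈ y) → ∀ y → ∃ λ x → f x ≈ y
  injective⇒surjective f f-inj y
    with Fin-injective⇒surjective (λ i → index (f (element i)))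
           (λ i j eq → element-injective (f-inj _ _ (index-injective eq))) (index y)
  ... | i , eq = element i , index-injective eq

  -- A map g sending a decidable set P onto P is injective on P.  Choosing for each element of P a
  -- preimage in P (and fixing the elements outside P) gives an injective, hence surjective, map on
  -- indices; so every a ∈ P is the chosen preimage of g a, which determines a from g a.
  module OntoSubset (P : Carrier → Set ℓ) (P? : ∀ x → Dec (P x)) (P-resp : ∀ {x y} → x ≈ y → P x → P y)
                    (g : Carrier → Carrier) (g-cong : ∀ {x y} → x ≈ y → g x ≈ g y)
                    (g-onto : ∀ y → P y → ∃ λ x → P x × g x ≈ y) where

    pick : ∀ y → Dec (P y) → Carrier
    pick y (yes Py) = proj₁ (g-onto y Py)
    pick y (no  _)  = y

    preimage : Fin N → Carrier
    preimage k = pick (element k) (P? (element k))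

    pick-injective : ∀ {y z} (dy : Dec (P y)) (dz : Dec (P z)) → pick y dy ≈ pick z dz → y ≈ z
    pick-injective {y} {z} (yes Py) (yes Pz) eq =
      trans (sym (proj₂ (proj₂ (g-onto y Py)))) (trans (g-cong eq) (proj₂ (proj₂ (g-onto z Pz))))
    pick-injective (yes Py) (no ¬Pz) eq = ⊥-elim (¬Pz (P-resp eq (proj₁ (proj₂ (g-onto _ Py)))))
    pick-injective (no ¬Py) (yes Pz) eq = ⊥-elim (¬Py (P-resp (sym eq) (proj₁ (proj₂ (g-onto _ Pz)))))
    pick-injective (no _)   (no _)   eq = eq

    chosen-preimage : ∀ a → P a → ∃ λ k → a ≈ preimage k × g a ≈ element k
    chosen-preimage a Pa
      with Fin-injective⇒surjective (λ k → index (preimage k))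
             (λ k l eq → element-injective (pick-injective (P? (element k)) (P? (element l)) (index-injective eq))) (index a)
    ... | k , eq = k , sym (index-injective eq) , image (P? (element k)) (index-injective eq)
      where
        image : (dk : Dec (P (element k))) → pick (element k) dk ≈ a → g a ≈ element k
        image (yes Pk) pick≈a = trans (g-cong (sym pick≈a)) (proj₂ (proj₂ (g-onto _ Pk)))
        image (no ¬Pk) pick≈a = ⊥-elim (¬Pk (P-resp (sym pick≈a) Pa))

    injectiveOn : ∀ a b → P a → P b → g a ≈ g b → a ≈ b
    injectiveOn a b Pa Pb ga≈gb with chosen-preimage a Pa | chosen-preimage b Pb
    ... | k , a≈ , ga≈ | l , b≈ , gb≈ with element-injective (trans (sym ga≈) (trans ga≈gb gb≈))
    ... | ≡.refl = trans a≈ (sym b≈)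

  module Reindexing (σ τ : Carrier → Carrier)
                    (σ-cong : ∀ {x y} → x ≈ y → σ x ≈ σ y) (τ-cong : ∀ {x y} → x ≈ y → τ x ≈ τ y)
                    (σ∘τ : ∀ x → σ (τ x) ≈ x) (τ∘σ : ∀ x → τ (σ x) ≈ x) where

    indexPermutation : Permutation N N
    indexPermutation = permutation (λ i → index (σ (element i))) (λ i → index (τ (element i)))
      (λ i → ≡.trans (index-cong (trans (σ-cong (element-index _)) (σ∘τ (element i)))) (index-element i))
      (λ i → ≡.trans (index-cong (trans (τ-cong (element-index _)) (τ∘σ (element i)))) (index-element i))

    module _ {a ℓ′} (M : CommutativeMonoid a ℓ′) where
      private module M = CommutativeMonoid M
      open MonoidSum M using (sum; ∑-permute; sum-cong-≋)

      reindex : (f : Carrier → M.Carrier) → (∀ {x y} → x ≈ y → f x M.≈ f y) →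
                sum (λ i → f (element i)) M.≈ sum (λ i → f (σ (element i)))
      reindex f f-cong = M.trans (∑-permute (λ i → f (element i)) indexPermutation)
                                 (sum-cong-≋ (λ i → f-cong (element-index (σ (element i)))))

  -- The characteristic divides N: summing x and 1 + x over the field gives Σ = N·1 + Σ.
  N·1≈0 : N · 1# ≈ 0#
  N·1≈0 = +-identityˡ-unique (N · 1#) total (sym (begin
    total                                     ≈⟨ Reindexing.reindex (1# +_) (- 1# +_) +-congˡ +-congˡ
                                                   (cancel 1#) (cancel′ 1#) +-commutativeMonoid (λ x → x) (λ eq → eq) ⟩
    Σ.sum (λ i → 1# + element i)              ≈⟨ Σ.∑-distrib-+ (λ _ → 1#) element ⟩
    Σ.sum {N} (λ _ → 1#) + total              ≈⟨ +-congʳ (Σ.sum-replicate N) ⟩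
    N · 1# + total                            ∎))
    where
      total : Carrier
      total = Σ.sum element
      cancel : ∀ a x → a + (- a + x) ≈ x
      cancel a x = trans (sym (+-assoc _ _ _)) (trans (+-congʳ (-‿inverseʳ a)) (+-identityˡ x))
      cancel′ : ∀ a x → - a + (a + x) ≈ x
      cancel′ a x = trans (sym (+-assoc _ _ _)) (trans (+-congʳ (-‿inverseˡ a)) (+-identityˡ x))

  ifZero : Carrier → Carrier → Carrier → Carrier
  ifZero y a b with y ≈? 0#
  ... | yes _ = a
  ... | no  _ = b

  ifZero-cases : ∀ y a b → (y ≈ 0# × ifZero y a b ≡ a) ⊎ (y ≉ 0# × ifZero y a b ≡ b)
  ifZero-cases y a b with y ≈? 0#
  ... | yes y≈0 = inj₁ (y≈0 , ≡.refl)
  ... | no  y≉0 = inj₂ (y≉0 , ≡.refl)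

  unit : Carrier → Carrier
  unit y = ifZero y 1# y

  unit-cong : ∀ {x y} → x ≈ y → unit x ≈ unit y
  unit-cong {x} {y} x≈y with ifZero-cases x 1# x | ifZero-cases y 1# y
  ... | inj₁ (_ , ux) | inj₁ (_ , uy) = reflexive (≡.trans ux (≡.sym uy))
  ... | inj₁ (x≈0 , _) | inj₂ (y≉0 , _) = ⊥-elim (y≉0 (trans (sym x≈y) x≈0))
  ... | inj₂ (x≉0 , _) | inj₁ (y≈0 , _) = ⊥-elim (x≉0 (trans x≈y y≈0))
  ... | inj₂ (_ , ux) | inj₂ (_ , uy) = trans (reflexive ux) (trans x≈y (reflexive (≡.sym uy)))

  unit-nonzero : ∀ y → unit y ≉ 0#
  unit-nonzero y with ifZero-cases y 1# y
  ... | inj₁ (_ , uy) = λ u≈0 → 0≉1 (sym (trans (reflexive (≡.sym uy)) u≈0))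
  ... | inj₂ (y≉0 , uy) = λ u≈0 → y≉0 (trans (reflexive (≡.sym uy)) u≈0)

  unit-* : ∀ {x} y → x ≉ 0# → unit (x * y) ≈ ifZero y 1# x * unit y
  unit-* {x} y x≉0 with ifZero-cases (x * y) 1# (x * y) | ifZero-cases y 1# x | ifZero-cases y 1# y
  ... | inj₁ (_ , uxy) | inj₁ (_ , vy) | inj₁ (_ , uy) =
    trans (reflexive uxy) (sym (trans (*-cong (reflexive vy) (reflexive uy)) (*-identityˡ 1#)))
  ... | inj₂ (_ , uxy) | inj₂ (_ , vy) | inj₂ (_ , uy) =
    trans (reflexive uxy) (sym (*-cong (reflexive vy) (reflexive uy)))
  ... | inj₁ (xy≈0 , _) | _ | inj₂ (y≉0 , _) = ⊥-elim (*-nonzero x≉0 y≉0 xy≈0)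
  ... | inj₂ (xy≉0 , _) | _ | inj₁ (y≈0 , _) = ⊥-elim (xy≉0 (trans (*-congˡ y≈0) (zeroʳ x)))
  ... | _ | inj₁ (y≈0 , _) | inj₂ (y≉0 , _) = ⊥-elim (y≉0 y≈0)
  ... | _ | inj₂ (y≉0 , _) | inj₁ (y≈0 , _) = ⊥-elim (y≉0 y≈0)

  Π-nonzero : ∀ n (f : Fin n → Carrier) → (∀ i → f i ≉ 0#) → Π.sum f ≉ 0#
  Π-nonzero ℕ.zero    f f≉0 1≈0 = 0≉1 (sym 1≈0)
  Π-nonzero (ℕ.suc n) f f≉0     = *-nonzero (f≉0 Fin.zero) (Π-nonzero n (λ i → f (Fin.suc i)) (λ i → f≉0 (Fin.suc i)))

  Π-all-but-one : ∀ {n} x (f : Fin n → Carrier) k → f k ≈ 1# → (∀ i → i ≢ k → f i ≈ x) → Π.sum f ≈ x ^ᴷ (n ℕ.∸ 1)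
  Π-all-but-one {ℕ.suc n} x f k fₖ≈1 fᵢ≈x = begin
    Π.sum f                                      ≈⟨ Π.sum-remove {i = k} f ⟩
    f k * Π.sum (λ j → f (Fin.punchIn k j))      ≈⟨ *-cong fₖ≈1 (Π.sum-cong-≋ {n} (λ j → fᵢ≈x _ (FinP.punchInᵢ≢i k j))) ⟩
    1# * Π.sum {n} (λ _ → x)                     ≈⟨ *-identityˡ _ ⟩
    Π.sum {n} (λ _ → x)                          ≈⟨ Π.sum-replicate n ⟩
    x ^ᴷ n                                       ∎

  -- Exactly one element of K is zero, so ∏ᵢ ifZero (element i) 1 x = x^(N-1).
  Π-ifZero : ∀ x → Π.sum (λ i → ifZero (element i) 1# x) ≈ x ^ᴷ (N ℕ.∸ 1)
  Π-ifZero x = Π-all-but-one x _ (index 0#) at-zero elsewhere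
    where
      at-zero : ifZero (element (index 0#)) 1# x ≈ 1#
      at-zero with ifZero-cases (element (index 0#)) 1# x
      ... | inj₁ (_ , eq)   = reflexive eq
      ... | inj₂ (e≉0 , _) = ⊥-elim (e≉0 (element-index 0#))
      elsewhere : ∀ i → i ≢ index 0# → ifZero (element i) 1# x ≈ x
      elsewhere i i≢ with ifZero-cases (element i) 1# x
      ... | inj₁ (eᵢ≈0 , _) = ⊥-elim (i≢ (≡.trans (≡.sym (index-element i)) (index-cong eᵢ≈0)))
      ... | inj₂ (_ , eq)   = reflexive eq

  -- Lagrange's theorem for the multiplicative group: x^(N-1) = 1 for x ≠ 0.  Multiplication by x
  -- permutes K, so P = ∏ unit(y) equals ∏ unit(x·y) = x^(N-1)·P, and P ≠ 0.
  lagrange : ∀ {x} → x ≉ 0# → x ^ᴷ (N ℕ.∸ 1) ≈ 1#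
  lagrange {x} x≉0 with inverse x x≉0
  ... | x⁻¹ , xx⁻¹≈1 = *-cancelʳ-nonzero (Π-nonzero N (λ i → unit (element i)) (λ i → unit-nonzero (element i))) (begin
    x ^ᴷ (N ℕ.∸ 1) * P                                        ≈⟨ *-congʳ (sym (Π-ifZero x)) ⟩
    Π.sum (λ i → ifZero (element i) 1# x) * P                 ≈⟨ sym (Π.∑-distrib-+ {N} _ _) ⟩
    Π.sum (λ i → ifZero (element i) 1# x * unit (element i))  ≈⟨ Π.sum-cong-≋ {N} (λ i → sym (unit-* (element i) x≉0)) ⟩
    Π.sum (λ i → unit (x * element i))                        ≈⟨ sym (Reindexing.reindex (x *_) (x⁻¹ *_) *-congˡ *-congˡ
                                                                   x*x⁻¹* x⁻¹*x* *-commutativeMonoid unit unit-cong) ⟩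
    P                                                         ≈⟨ sym (*-identityˡ P) ⟩
    1# * P                                                    ∎)
    where
      P : Carrier
      P = Π.sum (λ i → unit (element i))
      x⁻¹x≈1 : x⁻¹ * x ≈ 1#
      x⁻¹x≈1 = trans (*-comm x⁻¹ x) xx⁻¹≈1
      x*x⁻¹* : ∀ y → x * (x⁻¹ * y) ≈ y
      x*x⁻¹* y = trans (sym (*-assoc _ _ _)) (trans (*-congʳ xx⁻¹≈1) (*-identityˡ y))
      x⁻¹*x* : ∀ y → x⁻¹ * (x * y) ≈ y
      x⁻¹*x* y = trans (sym (*-assoc _ _ _)) (trans (*-congʳ x⁻¹x≈1) (*-identityˡ y))

  1≤N : 1 ℕ.≤ N
  1≤N = nonempty (index 0#)
    where
      nonempty : ∀ {n} → Fin n → 1 ℕ.≤ n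
      nonempty Fin.zero    = ℕ.s≤s ℕ.z≤n
      nonempty (Fin.suc _) = ℕ.s≤s ℕ.z≤n

  fermat : ∀ x → x ^ᴷ N ≈ x
  fermat x with x ≈? 0#
  ... | yes x≈0 = begin
    x ^ᴷ N                   ≈⟨ ^-congˡ N x≈0 ⟩
    0# ^ᴷ N                  ≡⟨ ≡.cong (0# ^ᴷ_) (≡.sym (ℕP.m+[n∸m]≡n 1≤N)) ⟩
    0# * 0# ^ᴷ (N ℕ.∸ 1)     ≈⟨ zeroˡ _ ⟩
    0#                       ≈⟨ sym x≈0 ⟩
    x                        ∎
  ... | no x≉0 = begin
    x ^ᴷ N                   ≡⟨ ≡.cong (x ^ᴷ_) (≡.sym (ℕP.m+[n∸m]≡n 1≤N)) ⟩
    x * x ^ᴷ (N ℕ.∸ 1)       ≈⟨ *-congˡ (lagrange x≉0) ⟩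
    x * 1#                   ≈⟨ *-identityʳ x ⟩
    x                        ∎

  -- For j ≥ 1 coprime to N - 1 the power map x ↦ x^j is injective: if x^j = y^j with y ≠ 0, then
  -- t = x·y⁻¹ has t^j = 1 and, by Lagrange, t^(N-1) = 1, hence t = 1.
  ^-injective : ∀ {j} → 1 ℕ.≤ j → Bézout.Identity 1 j (N ℕ.∸ 1) → ∀ x y → x ^ᴷ j ≈ y ^ᴷ j → x ≈ y
  ^-injective {j} 1≤j bézout x y xʲ≈yʲ with y ≈? 0#
  ... | yes y≈0 = trans (^-zero⇒ j (trans xʲ≈yʲ (trans (^-congˡ j y≈0) (0^n≈0 1≤j)))) (sym y≈0)
  ... | no  y≉0 with inverse y y≉0
  ... | y⁻¹ , yy⁻¹≈1 = begin
    x                  ≈⟨ sym (*-identityʳ x) ⟩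
    x * 1#             ≈⟨ *-congˡ (sym y⁻¹y≈1) ⟩
    x * (y⁻¹ * y)      ≈⟨ sym (*-assoc x y⁻¹ y) ⟩
    (x * y⁻¹) * y      ≈⟨ *-congʳ (coprime-orders tʲ≈1 (lagrange t≉0) bézout) ⟩
    1# * y             ≈⟨ *-identityˡ y ⟩
    y                  ∎
    where
      y⁻¹y≈1 : y⁻¹ * y ≈ 1#
      y⁻¹y≈1 = trans (*-comm y⁻¹ y) yy⁻¹≈1
      tʲ≈1 : (x * y⁻¹) ^ᴷ j ≈ 1#
      tʲ≈1 = begin
        (x * y⁻¹) ^ᴷ j         ≈⟨ ^-distrib-* x y⁻¹ j ⟩
        x ^ᴷ j * y⁻¹ ^ᴷ j      ≈⟨ *-congʳ xʲ≈yʲ ⟩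
        y ^ᴷ j * y⁻¹ ^ᴷ j      ≈⟨ sym (^-distrib-* y y⁻¹ j) ⟩
        (y * y⁻¹) ^ᴷ j         ≈⟨ ^-congˡ j yy⁻¹≈1 ⟩
        1# ^ᴷ j                ≈⟨ 1^n≈1 j ⟩
        1#                     ∎
      t≉0 : x * y⁻¹ ≉ 0#
      t≉0 t≈0 = 0≉1 (trans (sym (0^n≈0 1≤j)) (trans (^-congˡ j (sym t≈0)) tʲ≈1))

  jth-root : ∀ {j} → 1 ℕ.≤ j → Bézout.Identity 1 j (N ℕ.∸ 1) → ∀ w → ∃ λ y → y ^ᴷ j ≈ w
  jth-root {j} 1≤j bézout = injective⇒surjective (_^ᴷ j) (^-injective 1≤j bézout)

  module Frobenius {p s} (p-prime : Prime p) (N≡pˢ : N ≡ p ℕ.^ s) where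

    ·1-^ : ∀ a n → (a · 1#) ^ᴷ n ≈ (a ℕ.^ n) · 1#
    ·1-^ a ℕ.zero    = sym (+-identityʳ 1#)
    ·1-^ a (ℕ.suc n) = trans (*-congˡ (·1-^ a n)) (sym (×1-homo-* a (a ℕ.^ n)))

    -- (p·1)^s = N·1 = 0, so p·1 = 0.
    p·1≈0 : p · 1# ≈ 0#
    p·1≈0 = ^-zero⇒ s (trans (·1-^ p s) (trans (reflexive (≡.cong (_· 1#) (≡.sym N≡pˢ))) N·1≈0))

    p·x≈0 : ∀ x → p · x ≈ 0#
    p·x≈0 x = begin
      p · x            ≈⟨ ×-congʳ p (sym (*-identityˡ x)) ⟩
      p · (1# * x)     ≈⟨ sym (×-assoc-* p 1# x) ⟩
      (p · 1#) * x     ≈⟨ *-congʳ p·1≈0 ⟩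
      0# * x           ≈⟨ zeroˡ x ⟩
      0#               ∎

    inner-binomials-vanish : ∀ k → 0 ℕ.< k → k ℕ.< p → ∀ z → (p C k) · z ≈ 0#
    inner-binomials-vanish k 0<k k<p z with Binomials.prime∣binomial p-prime k 0<k k<p
    ... | divides d pCk≡d*p = begin
      (p C k) · z         ≡⟨ ≡.cong (_· z) pCk≡d*p ⟩
      (d ℕ.* p) · z       ≈⟨ sym (×-assocˡ z d p) ⟩
      d · (p · z)         ≈⟨ ×-congʳ d (p·x≈0 z) ⟩
      d · 0#              ≈⟨ ·0≈0 d ⟩
      0#                  ∎
      where
        ·0≈0 : ∀ n → n · 0# ≈ 0#
        ·0≈0 ℕ.zero    = refl
        ·0≈0 (ℕ.suc n) = trans (+-identityˡ _) (·0≈0 n)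

    frobenius-p : ∀ x y → (x + y) ^ᴷ p ≈ x ^ᴷ p + y ^ᴷ p
    frobenius-p = dream p-prime inner-binomials-vanish
      where
        dream : ∀ {r} → Prime r → (∀ k → 0 ℕ.< k → k ℕ.< r → ∀ z → (r C k) · z ≈ 0#) →
                ∀ x y → (x + y) ^ᴷ r ≈ x ^ᴷ r + y ^ᴷ r
        dream {ℕ.zero}  r-prime = ⊥-elim (¬prime[0] r-prime)
        dream {ℕ.suc n} _       = freshman's-dream n

    frobenius : ∀ n x y → (x + y) ^ᴷ (p ℕ.^ n) ≈ x ^ᴷ (p ℕ.^ n) + y ^ᴷ (p ℕ.^ n)
    frobenius ℕ.zero    x y = trans (*-identityʳ _) (sym (+-cong (*-identityʳ x) (*-identityʳ y)))
    frobenius (ℕ.suc n) x y = begin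
      (x + y) ^ᴷ (p ℕ.* p ℕ.^ n)                       ≈⟨ sym (^-assocʳ (x + y) p (p ℕ.^ n)) ⟩
      ((x + y) ^ᴷ p) ^ᴷ (p ℕ.^ n)                      ≈⟨ ^-congˡ (p ℕ.^ n) (frobenius-p x y) ⟩
      (x ^ᴷ p + y ^ᴷ p) ^ᴷ (p ℕ.^ n)                   ≈⟨ frobenius n _ _ ⟩
      (x ^ᴷ p) ^ᴷ (p ℕ.^ n) + (y ^ᴷ p) ^ᴷ (p ℕ.^ n)    ≈⟨ +-cong (^-assocʳ x p _) (^-assocʳ y p _) ⟩
      x ^ᴷ (p ℕ.* p ℕ.^ n) + y ^ᴷ (p ℕ.* p ℕ.^ n)      ∎

  non-root : ∀ d {lc f} → Deg d lc f → lc ≉ 0# → d ℕ.< N → ∃ λ x → f x ≉ 0#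
  non-root d {f = f} D lc≉0 d<N
    with FinP.¬∀⟶∃¬ N (λ i → f (element i) ≈ 0#) (λ i → f (element i) ≈? 0#)
           (λ all-roots → ℕP.<⇒≱ d<N (root-bound d D lc≉0 N element (λ i j → element-injective) all-roots))
  ... | i , fᵢ≉0 = element i , fᵢ≉0

module SubfieldTrace {c ℓ} (q m : ℕ.ℕ) (q-prime-power : IsPrimePower q) (K : FiniteField c ℓ (q ℕ.^ m)) where
  open FiniteField K
  open FieldOps field' renaming (_^_ to _^ᴷ_)
  open FieldLemmas field'
  open FiniteFieldLemmas K
  open import Algebra.Properties.Semiring.Exp semiring using (^-congˡ; ^-congʳ; ^-assocʳ)
  open import Algebra.Properties.CommutativeSemiring.Exp commutativeSemiring using (^-distrib-*)
  open import Algebra.Properties.Ring ring using (x+x≈x⇒x≈0; +-inverseˡ-unique; +-cancelʳ; x∙y⁻¹≈ε⇒x≈y; -1*x≈-x)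
  open import Relation.Binary.Reasoning.Setoid setoid

  p : ℕ.ℕ
  p = proj₁ q-prime-power
  k : ℕ.ℕ
  k = proj₁ (proj₂ q-prime-power)
  p-prime : Prime p
  p-prime = proj₁ (proj₂ (proj₂ q-prime-power))
  1≤k : 1 ℕ.≤ k
  1≤k = proj₁ (proj₂ (proj₂ (proj₂ q-prime-power)))
  q≡pᵏ : q ≡ p ℕ.^ k
  q≡pᵏ = proj₂ (proj₂ (proj₂ (proj₂ q-prime-power)))

  -- q^i = p^(k·i); in particular |K| = p^(k·m), so K has characteristic p.
  qⁱ≡pᵏⁱ : ∀ i → q ℕ.^ i ≡ p ℕ.^ (k ℕ.* i)
  qⁱ≡pᵏⁱ i = ≡.trans (≡.cong (ℕ._^ i) q≡pᵏ) (ℕP.^-*-assoc p k i)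

  open Frobenius {s = k ℕ.* m} p-prime (qⁱ≡pᵏⁱ m)

  2≤q : 2 ℕ.≤ q
  2≤q = ≡.subst (2 ℕ.≤_) (≡.sym q≡pᵏ) (ℕP.^-monoʳ-< p (2≤prime p-prime) 1≤k)
    where
      2≤prime : ∀ {r} → Prime r → 2 ℕ.≤ r
      2≤prime {0} r-prime = ⊥-elim (¬prime[0] r-prime)
      2≤prime {1} r-prime = ⊥-elim (¬prime[1] r-prime)
      2≤prime {ℕ.suc (ℕ.suc _)} _ = ℕ.s≤s (ℕ.s≤s ℕ.z≤n)

  1≤q : 1 ℕ.≤ q
  1≤q = ℕP.≤-trans (ℕ.s≤s ℕ.z≤n) 2≤q

  frobenius-qⁱ : ∀ i x y → (x + y) ^ᴷ (q ℕ.^ i) ≈ x ^ᴷ (q ℕ.^ i) + y ^ᴷ (q ℕ.^ i)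
  frobenius-qⁱ i x y = begin
    (x + y) ^ᴷ (q ℕ.^ i)                                 ≡⟨ ≡.cong ((x + y) ^ᴷ_) (qⁱ≡pᵏⁱ i) ⟩
    (x + y) ^ᴷ (p ℕ.^ (k ℕ.* i))                         ≈⟨ frobenius (k ℕ.* i) x y ⟩
    x ^ᴷ (p ℕ.^ (k ℕ.* i)) + y ^ᴷ (p ℕ.^ (k ℕ.* i))      ≡⟨ ≡.cong (λ e → x ^ᴷ e + y ^ᴷ e) (≡.sym (qⁱ≡pᵏⁱ i)) ⟩
    x ^ᴷ (q ℕ.^ i) + y ^ᴷ (q ℕ.^ i)                      ∎

  frobenius-q : ∀ x y → (x + y) ^ᴷ q ≈ x ^ᴷ q + y ^ᴷ q
  frobenius-q x y = ≡.subst (λ e → (x + y) ^ᴷ e ≈ x ^ᴷ e + y ^ᴷ e) (ℕP.*-identityʳ q) (frobenius-qⁱ 1 x y)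

  F_q : Carrier → Set ℓ
  F_q = InSub q

  F_q? : ∀ x → Dec (F_q x)
  F_q? x = x ^ᴷ q ≈? x

  F_q-resp : ∀ {x y} → x ≈ y → F_q x → F_q y
  F_q-resp x≈y xᵠ≈x = trans (^-congˡ q (sym x≈y)) (trans xᵠ≈x x≈y)

  F_q-0 : F_q 0#
  F_q-0 = 0^n≈0 1≤q

  F_q-1 : F_q 1#
  F_q-1 = 1^n≈1 q

  F_q-+ : ∀ {x y} → F_q x → F_q y → F_q (x + y)
  F_q-+ x∈ y∈ = trans (frobenius-q _ _) (+-cong x∈ y∈)

  F_q-* : ∀ {x y} → F_q x → F_q y → F_q (x * y)
  F_q-* x∈ y∈ = trans (^-distrib-* _ _ q) (*-cong x∈ y∈)

  F_q-^ : ∀ {x} n → F_q x → F_q (x ^ᴷ n)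
  F_q-^ ℕ.zero    x∈ = F_q-1
  F_q-^ (ℕ.suc n) x∈ = F_q-* x∈ (F_q-^ n x∈)

  F_q-⁻¹ : ∀ {x y} → x ≉ 0# → x * y ≈ 1# → F_q x → F_q y
  F_q-⁻¹ {x} {y} x≉0 xy≈1 x∈ = *-cancelʳ-nonzero x≉0 (begin
    y ^ᴷ q * x           ≈⟨ *-congˡ (sym x∈) ⟩
    y ^ᴷ q * x ^ᴷ q      ≈⟨ sym (^-distrib-* y x q) ⟩
    (y * x) ^ᴷ q         ≈⟨ ^-congˡ q (trans (*-comm y x) xy≈1) ⟩
    1# ^ᴷ q              ≈⟨ F_q-1 ⟩
    1#                   ≈⟨ sym (trans (*-comm y x) xy≈1) ⟩
    y * x                ∎)

  F_q-eval : ∀ {h} → PolyOver q h → ∀ {a} → F_q a → F_q (eval h a)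
  F_q-eval []          a∈ = F_q-0
  F_q-eval (c∈ ∷ h∈) a∈ = F_q-+ c∈ (F_q-* a∈ (F_q-eval h∈ a∈))

  F_q-fixed : ∀ {a} i → F_q a → a ^ᴷ (q ℕ.^ i) ≈ a
  F_q-fixed ℕ.zero        a∈ = *-identityʳ _
  F_q-fixed {a} (ℕ.suc i) a∈ = begin
    a ^ᴷ (q ℕ.* q ℕ.^ i)     ≈⟨ sym (^-assocʳ a q (q ℕ.^ i)) ⟩
    (a ^ᴷ q) ^ᴷ (q ℕ.^ i)    ≈⟨ ^-congˡ (q ℕ.^ i) a∈ ⟩
    a ^ᴷ (q ℕ.^ i)           ≈⟨ F_q-fixed i a∈ ⟩
    a                        ∎

  Tr : Carrier → Carrier
  Tr y = sumTo m (λ i → y ^ᴷ (q ℕ.^ i))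

  Tr-cong : ∀ {x y} → x ≈ y → Tr x ≈ Tr y
  Tr-cong x≈y = sumTo-cong m (λ i → ^-congˡ (q ℕ.^ i) x≈y)

  Tr-+ : ∀ x y → Tr (x + y) ≈ Tr x + Tr y
  Tr-+ x y = trans (sumTo-cong m (λ i → frobenius-qⁱ i x y)) (sumTo-+ m _ _)

  Tr-scale : ∀ a y → F_q a → Tr (y * a) ≈ Tr y * a
  Tr-scale a y a∈ = begin
    Tr (y * a)                                  ≈⟨ sumTo-cong m (λ i → trans (^-distrib-* y a (q ℕ.^ i)) (*-comm _ _)) ⟩
    sumTo m (λ i → a ^ᴷ (q ℕ.^ i) * y ^ᴷ (q ℕ.^ i))  ≈⟨ sumTo-cong m (λ i → *-congʳ (F_q-fixed i a∈)) ⟩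
    sumTo m (λ i → a * y ^ᴷ (q ℕ.^ i))          ≈⟨ sumTo-scale m a _ ⟩
    a * Tr y                                    ≈⟨ *-comm a (Tr y) ⟩
    Tr y * a                                    ∎

  Tr-0 : Tr 0# ≈ 0#
  Tr-0 = x+x≈x⇒x≈0 (Tr 0#) (trans (sym (Tr-+ 0# 0#)) (Tr-cong (+-identityˡ 0#)))

  Tr-neg : ∀ y → Tr (- y) ≈ - Tr y
  Tr-neg y = +-inverseˡ-unique (Tr (- y)) (Tr y)
    (trans (sym (Tr-+ (- y) y)) (trans (Tr-cong (-‿inverseˡ y)) Tr-0))

  -- Σ_{i<m} y^(q^(i+1)) = Tr y, since y^(q^m) = y.
  Tr-shift : ∀ y → sumTo m (λ i → y ^ᴷ (q ℕ.^ ℕ.suc i)) ≈ Tr y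
  Tr-shift y = +-cancelʳ (y ^ᴷ (q ℕ.^ 0)) _ _ (begin
    sumTo m (λ i → y ^ᴷ (q ℕ.^ ℕ.suc i)) + y ^ᴷ (q ℕ.^ 0)  ≈⟨ sumTo-shift m (λ i → y ^ᴷ (q ℕ.^ i)) ⟩
    Tr y + y ^ᴷ (q ℕ.^ m)                                  ≈⟨ +-congˡ (trans (fermat y) (sym (*-identityʳ y))) ⟩
    Tr y + y ^ᴷ (q ℕ.^ 0)                                  ∎)

  F_q-Tr : ∀ y → F_q (Tr y)
  F_q-Tr y = begin
    Tr y ^ᴷ q                                     ≈⟨ sumTo-^q m _ ⟩
    sumTo m (λ i → (y ^ᴷ (q ℕ.^ i)) ^ᴷ q)         ≈⟨ sumTo-cong m (λ i → trans (^-assocʳ y (q ℕ.^ i) q) (^-congʳ y (ℕP.*-comm (q ℕ.^ i) q))) ⟩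
    sumTo m (λ i → y ^ᴷ (q ℕ.^ ℕ.suc i))          ≈⟨ Tr-shift y ⟩
    Tr y                                          ∎
    where
      sumTo-^q : ∀ n f → sumTo n f ^ᴷ q ≈ sumTo n (λ i → f i ^ᴷ q)
      sumTo-^q ℕ.zero    f = F_q-0
      sumTo-^q (ℕ.suc n) f = trans (frobenius-q _ _) (+-congʳ (sumTo-^q n f))

  Tr-^q : ∀ y → Tr (y ^ᴷ q) ≈ Tr y
  Tr-^q y = trans (sumTo-cong m (λ i → ^-assocʳ y q (q ℕ.^ i))) (Tr-shift y)

  -- For m ≥ 1, Tr is a nonzero polynomial function of degree q^(m-1) < q^m, so it has a non-root.
  Tr-nonvanishing : 1 ℕ.≤ m → ∃ λ x → Tr x ≉ 0#
  Tr-nonvanishing 1≤m = ≡.subst (λ n → ∃ λ x → sumTo n (λ i → x ^ᴷ (q ℕ.^ i)) ≉ 0#)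
                                (ℕP.m+[n∸m]≡n 1≤m) (partial-trace-nonvanishing (m ℕ.∸ 1) m-1<m)
    where
      m-1<m : m ℕ.∸ 1 ℕ.< m
      m-1<m = ℕP.∸-monoʳ-< {m} {1} {0} (ℕ.s≤s ℕ.z≤n) 1≤m
      partial-trace-nonvanishing : ∀ n → n ℕ.< m → ∃ λ x → sumTo (ℕ.suc n) (λ i → x ^ᴷ (q ℕ.^ i)) ≉ 0#
      partial-trace-nonvanishing n n<m = non-root (q ℕ.^ n)
        (deg-lc (q ℕ.^ n) (deg-+ (q ℕ.^ n) (deg-sumTo n (q ℕ.^ n) (q ℕ.^_) (λ i → ℕP.^-monoʳ-< q 2≤q))
                                           (deg-^ (q ℕ.^ n)))
                (+-identityˡ 1#))
        (λ 1≈0 → 0≉1 (sym 1≈0)) (ℕP.^-monoʳ-< q 2≤q n<m)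

  -- Tr maps K onto F_q: if Tr x₀ = c ≠ 0 then Tr (x₀·(c⁻¹·a)) = c·c⁻¹·a = a for a ∈ F_q.
  Tr-onto : 1 ℕ.≤ m → ∀ a → F_q a → ∃ λ y → Tr y ≈ a
  Tr-onto 1≤m a a∈ with Tr-nonvanishing 1≤m
  ... | x₀ , c≉0 with inverse (Tr x₀) c≉0
  ... | c⁻¹ , cc⁻¹≈1 = x₀ * (c⁻¹ * a) , (begin
    Tr (x₀ * (c⁻¹ * a))     ≈⟨ Tr-scale _ x₀ (F_q-* (F_q-⁻¹ c≉0 cc⁻¹≈1 (F_q-Tr x₀)) a∈) ⟩
    Tr x₀ * (c⁻¹ * a)       ≈⟨ sym (*-assoc _ _ _) ⟩
    (Tr x₀ * c⁻¹) * a       ≈⟨ *-congʳ cc⁻¹≈1 ⟩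
    1# * a                  ≈⟨ *-identityˡ a ⟩
    a                       ∎)

  -- If Tr vanishes only at 0 then K = F_q.  With c₀ = Tr x₀ ≠ 0, each w = z·c₀ - x₀·Tr z has
  -- Tr w = 0, so z·c₀ = x₀·Tr z; since Tr (z^q) = Tr z, this gives z^q·c₀ = z·c₀.
  Tr-injective⇒F_q-everything : 1 ℕ.≤ m → (∀ w → Tr w ≈ 0# → w ≈ 0#) → ∀ z → F_q z
  Tr-injective⇒F_q-everything 1≤m Tr-kernel z with Tr-nonvanishing 1≤m
  ... | x₀ , c₀≉0 = *-cancelʳ-nonzero c₀≉0 (begin
    z ^ᴷ q * c₀         ≈⟨ through-x₀ (z ^ᴷ q) ⟩
    x₀ * Tr (z ^ᴷ q)    ≈⟨ *-congˡ (Tr-^q z) ⟩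
    x₀ * Tr z           ≈⟨ sym (through-x₀ z) ⟩
    z * c₀              ∎)
    where
      c₀ : Carrier
      c₀ = Tr x₀
      through-x₀ : ∀ y → y * c₀ ≈ x₀ * Tr y
      through-x₀ y = x∙y⁻¹≈ε⇒x≈y _ _ (Tr-kernel _ (begin
        Tr (y * c₀ - x₀ * Tr y)           ≈⟨ Tr-+ _ _ ⟩
        Tr (y * c₀) + Tr (- (x₀ * Tr y)) ≈⟨ +-cong (Tr-scale c₀ y (F_q-Tr x₀)) (trans (Tr-neg _) (-‿cong (Tr-scale (Tr y) x₀ (F_q-Tr y)))) ⟩
        Tr y * c₀ - c₀ * Tr y             ≈⟨ +-congˡ (-‿cong (*-comm c₀ (Tr y))) ⟩
        Tr y * c₀ - Tr y * c₀             ≈⟨ -‿inverseʳ _ ⟩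
        0#                                ∎))

  -- For m ≥ 2 the subfield is proper: x^q - x has degree q < q^m, so it has a non-root.
  F_q-proper : 2 ℕ.≤ m → ∃ λ z → ¬ F_q z
  F_q-proper 2≤m with non-root q {f = λ z → z ^ᴷ q + - 1# * z ^ᴷ 1}
                        (deg-+ q (deg-^ q) (deg-liftTo 1 q (deg-scale 1 (- 1#) (deg-^ 1)) 2≤q))
                        (λ 1+0≈0 → 0≉1 (sym (trans (sym (+-identityʳ 1#)) 1+0≈0)))
                        (≡.subst (ℕ._< q ℕ.^ m) (ℕP.*-identityʳ q) (ℕP.^-monoʳ-< q 2≤q 2≤m))
  ... | z , nonroot = z , λ z∈ → nonroot (begin
    z ^ᴷ q + - 1# * z ^ᴷ 1   ≈⟨ +-cong z∈ (trans (-1*x≈-x _) (-‿cong (*-identityʳ z))) ⟩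
    z - z                    ≈⟨ -‿inverseʳ z ⟩
    0#                       ∎)

module PermutationCriterion {c ℓ} (q m j : ℕ) (q-prime-power : IsPrimePower q) (2≤m : 2 ≤ m) (1≤j : 1 ≤ j)
                            (coprime : gcd j (q ^ m ∸ 1) ≡ 1) (K : FiniteField c ℓ (q ^ m)) where
  open FiniteField K
  open FieldOps field' renaming (_^_ to _^ᴷ_)
  open FieldLemmas field'
  open FiniteFieldLemmas K
  open SubfieldTrace q m q-prime-power K
  open import Algebra.Properties.Semiring.Exp semiring using (^-congˡ; ^-assocʳ)
  open import Algebra.Properties.CommutativeSemiring.Exp commutativeSemiring using (^-distrib-*)
  open import Relation.Binary.Reasoning.Setoid setoid

  1≤m : 1 ℕ.≤ m
  1≤m = ℕP.≤-trans (ℕ.s≤s ℕ.z≤n) 2≤m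

  bézout : Bézout.Identity 1 j (q ^ m ∸ 1)
  bézout = coprime-Bézout (gcd≡1⇒coprime coprime)

  μⱼ : Carrier → Carrier
  μⱼ = μ q m j

  μ≈Tr : ∀ x → μⱼ x ≈ Tr (x ^ᴷ j)
  μ≈Tr x = sumTo-cong m (λ i → sym (^-assocʳ x j (q ℕ.^ i)))

  μ-cong : ∀ {x y} → x ≈ y → μⱼ x ≈ μⱼ y
  μ-cong {x} {y} x≈y = trans (μ≈Tr x) (trans (Tr-cong (^-congˡ j x≈y)) (sym (μ≈Tr y)))

  F_q-μ : ∀ x → F_q (μⱼ x)
  F_q-μ x = F_q-resp (sym (μ≈Tr x)) (F_q-Tr _)

  -- μ_j maps K onto F_q, since x ↦ x^j is onto K and Tr is onto F_q.
  μ-onto : ∀ a → F_q a → ∃ λ x → μⱼ x ≈ a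
  μ-onto a a∈ with Tr-onto 1≤m a a∈
  ... | y , Tr-y≈a with jth-root 1≤j bézout y
  ... | x , xʲ≈y = x , trans (μ≈Tr x) (trans (Tr-cong xʲ≈y) Tr-y≈a)

  -- μ_j vanishes at some nonzero point: otherwise Tr would vanish only at 0 (every w is some x^j),
  -- forcing K = F_q, which fails for m ≥ 2.
  μ-kernel-nontrivial : ¬ (∀ x → μⱼ x ≈ 0# → x ≈ 0#)
  μ-kernel-nontrivial μ-kernel with F_q-proper 2≤m
  ... | z , z∉F_q = z∉F_q (Tr-injective⇒F_q-everything 1≤m Tr-kernel z)
    where
      Tr-kernel : ∀ w → Tr w ≈ 0# → w ≈ 0#
      Tr-kernel w Tr-w≈0 with jth-root 1≤j bézout w
      ... | x , xʲ≈w = begin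
        w          ≈⟨ sym xʲ≈w ⟩
        x ^ᴷ j     ≈⟨ ^-congˡ j x≈0 ⟩
        0# ^ᴷ j    ≈⟨ 0^n≈0 1≤j ⟩
        0#         ∎
        where
          x≈0 : x ≈ 0#
          x≈0 = μ-kernel x (trans (μ≈Tr x) (trans (Tr-cong xʲ≈w) Tr-w≈0))

  module _ (h : Poly) (h∈ : PolyOver q h) where
    H : Carrier → Carrier
    H = eval h

    f : Carrier → Carrier
    f x = x * H (μⱼ x)

    g : Carrier → Carrier
    g a = a * H a ^ᴷ j

    H-cong : ∀ {a b} → a ≈ b → H a ≈ H b
    H-cong = eval-cong h

    g-cong : ∀ {a b} → a ≈ b → g a ≈ g b
    g-cong a≈b = *-cong a≈b (^-congˡ j (H-cong a≈b))

    F_q-g : ∀ a → F_q a → F_q (g a)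
    F_q-g a a∈ = F_q-* a∈ (F_q-^ j (F_q-eval h∈ a∈))

    -- The commutative square μ_j ∘ f = g ∘ μ_j: since h(μ_j x)^j ∈ F_q, it can be pulled out of Tr.
    μ∘f≈g∘μ : ∀ x → μⱼ (f x) ≈ g (μⱼ x)
    μ∘f≈g∘μ x = begin
      μⱼ (f x)                        ≈⟨ μ≈Tr (f x) ⟩
      Tr ((x * Hμx) ^ᴷ j)             ≈⟨ Tr-cong (^-distrib-* x Hμx j) ⟩
      Tr (x ^ᴷ j * Hμx ^ᴷ j)          ≈⟨ Tr-scale _ _ (F_q-^ j (F_q-eval h∈ (F_q-μ x))) ⟩
      Tr (x ^ᴷ j) * Hμx ^ᴷ j          ≈⟨ *-congʳ (sym (μ≈Tr x)) ⟩
      μⱼ x * Hμx ^ᴷ j                 ∎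
      where Hμx = H (μⱼ x)

    -- If h(0) ≠ 0 and g permutes F_q then f is injective, hence a permutation of K:
    -- f x = f y gives g(μ x) = g(μ y), so μ x = μ y and then x·h(μ x) = y·h(μ x) with h(μ x) ≠ 0.
    sufficient : ¬ (H 0# ≈ 0#) × PermutesOn F_q g → Permutes f
    sufficient (H0≉0 , _ , g-injective , _) = f-injective , injective⇒surjective f f-injective
      where
        H≉0 : ∀ a → F_q a → H a ≉ 0#
        H≉0 a a∈ Ha≈0 = H0≉0 (trans (H-cong (sym a≈0)) Ha≈0)
          where
            a≈0 : a ≈ 0#
            a≈0 = g-injective a 0# a∈ F_q-0 (begin
              a * H a ^ᴷ j     ≈⟨ *-congˡ (trans (^-congˡ j Ha≈0) (0^n≈0 1≤j)) ⟩
              a * 0#           ≈⟨ zeroʳ a ⟩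
              0#               ≈⟨ sym (zeroˡ _) ⟩
              g 0#             ∎)
        f-injective : ∀ x y → f x ≈ f y → x ≈ y
        f-injective x y fx≈fy = *-cancelʳ-nonzero (H≉0 _ (F_q-μ x)) (begin
          x * H (μⱼ x)   ≈⟨ fx≈fy ⟩
          y * H (μⱼ y)   ≈⟨ *-congˡ (H-cong (sym μx≈μy)) ⟩
          y * H (μⱼ x)   ∎)
          where
            μx≈μy : μⱼ x ≈ μⱼ y
            μx≈μy = g-injective _ _ (F_q-μ x) (F_q-μ y)
                      (trans (sym (μ∘f≈g∘μ x)) (trans (μ-cong fx≈fy) (μ∘f≈g∘μ y)))

    -- If f permutes K then g maps F_q onto F_q (μ is onto F_q), hence permutes it; and h(0) ≠ 0,
    -- for otherwise f, being injective with f(0) = 0, would force μ_j to vanish only at 0.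
    necessary : Permutes f → ¬ (H 0# ≈ 0#) × PermutesOn F_q g
    necessary (f-injective , f-onto) =
      H0≉0 , F_q-g , OntoSubset.injectiveOn F_q F_q? F_q-resp g g-cong g-onto , g-onto
      where
        g-onto : ∀ b → F_q b → ∃ λ a → F_q a × g a ≈ b
        g-onto b b∈ with μ-onto b b∈
        ... | x , μx≈b with f-onto x
        ... | y , fy≈x = μⱼ y , F_q-μ y , trans (sym (μ∘f≈g∘μ y)) (trans (μ-cong fy≈x) μx≈b)
        H0≉0 : ¬ (H 0# ≈ 0#)
        H0≉0 H0≈0 = μ-kernel-nontrivial (λ x μx≈0 → f-injective x 0# (begin
          x * H (μⱼ x)    ≈⟨ *-congˡ (trans (H-cong μx≈0) H0≈0) ⟩
          x * 0#          ≈⟨ zeroʳ x ⟩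
          0#              ≈⟨ sym (zeroˡ _) ⟩
          f 0#            ∎))

theorem3p2 : ∀ {c ℓ : Level} (q m j : ℕ) → IsPrimePower q → 2 ≤ m → 1 ≤ j → j ≤ q ^ m ∸ 1 → gcd j (q ^ m ∸ 1) ≡ 1
    → (K : FiniteField c ℓ (q ^ m))
    → let open FiniteField K in let open FieldOps field' renaming (_^_ to _^ᴷ_) in
    (h : Poly) → PolyOver q h
    → Permutes (λ x → x * eval h (μ q m j x))
    ⇔ (¬ (eval h 0# ≈ 0#) × PermutesOn (InSub q) (λ x → x * (eval h x ^ᴷ j)))
theorem3p2 q m j q-prime-power 2≤m 1≤j _ coprime K h h∈ = mk⇔ (necessary h h∈) (sufficient h h∈)
  where open PermutationCriterion q m j q-prime-power 2≤m 1≤j coprime K
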